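{- Let $S=(S_{ij})_{i,j\ge 0}$ be the infinite lower-triangular matrix with $S_{ij}=\binom{i}{j}\bmod 2\in\{0,1\}$. For nonnegative integers $i,j$, say $i$ is free of $j$ if the binary expansion of $i$ has 0s in all positions where that of $j$ has 1s, and let $b(n)$ denote the sum of the binary digits of $n$. For a number $x$, let $S(x)$ be the infinite lower-triangular matrix with $S(x)_{ij}=x^{b(i-j)}$ if $i\ge j\ge 0$ and $i-j$ is free of $j$, and $S(x)_{ij}=0$ otherwise (so $S(1)=S$). Then for every rational number $r$, $S^{r}=S(r)$; that is, for all integers $p$ and positive integers $q$ with $r=p/q$, one has $S(p/q)^{q}=S^{p}$ (where for $p<0$, $S^p$ means $(S^{ -1})^{ -p}$). In particular $S^{ -1}=S(-1)$ and $S^0=I=S(0)$.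
   Context: Infinite lower-triangular matrices are multiplied in the usual way (each entry of a product is a finite sum); $S$ is lower unitriangular and hence invertible. Convention: $0^0=1$, so $S(0)$ is the identity matrix. -}

module Defs where

open import Data.Nat as ℕ using (ℕ; zero; suc; _∸_; _≤ᵇ_; _%_; _/_; _≡ᵇ_)
open import Data.Nat.Combinatorics using (_C_)
open import Data.Bool using (Bool; true; false; _∧_; not; if_then_else_)
open import Data.List using (List; []; _∷_)
open import Data.Integer using (ℤ; +_; -[1+_])
open import Data.Rational using (ℚ; 0ℚ; 1ℚ; _+_; _*_; -_)

-- Power of a rational with natural exponent (convention 0^0 = 1).
_^ℚ_ : ℚ → ℕ → ℚ
x ^ℚ zero  = 1ℚ
x ^ℚ suc n = x * (x ^ℚ n)

-- Binary digits of n, least significant first.  With fuel = n the list is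
-- long enough (n < 2^n), so every binary digit of n beyond the list is 0.
bitsFuel : ℕ → ℕ → List Bool
bitsFuel zero     n = []
bitsFuel (suc f) n = (n % 2 ≡ᵇ 1) ∷ bitsFuel f (n / 2)

bits : ℕ → List Bool
bits n = bitsFuel n n

countOnes : List Bool → ℕ
countOnes []            = 0
countOnes (true  ∷ bs)  = suc (countOnes bs)
countOnes (false ∷ bs)  = countOnes bs

b : ℕ → ℕ
b n = countOnes (bits n)

freeL : List Bool → List Bool → Bool
freeL _        []        = true
freeL []       (_ ∷ _)   = true
freeL (x ∷ xs) (y ∷ ys)  = not (x ∧ y) ∧ freeL xs ys

free : ℕ → ℕ → Bool
free i j = freeL (bits i) (bits j)

Mat : Set
Mat = ℕ → ℕ → ℚ

sumTo : ℕ → (ℕ → ℚ) → ℚ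
sumTo zero    f = 0ℚ
sumTo (suc n) f = sumTo n f + f n

-- Product of lower-triangular matrices: (AB)_{ij} = Σ_{k=0}^{i} A_{ik} B_{kj}
-- (the terms with k > i vanish since A is lower triangular).
_⊗_ : Mat → Mat → Mat
(A ⊗ B) i j = sumTo (suc i) (λ k → A i k * B k j)

I : Mat
I i j = if i ≡ᵇ j then 1ℚ else 0ℚ

_^M_ : Mat → ℕ → Mat
A ^M zero  = I
A ^M suc n = A ⊗ (A ^M n)

-- Inverse of a lower unitriangular matrix A by forward substitution,
-- i.e. the unique lower-triangular T with A T = I:
--   T_{jj} = 1,  T_{j+n+1, j} = - Σ_{k=j}^{j+n} A_{j+n+1, k} T_{k j},  T_{ij} = 0 for i < j.
-- invCol A j n is the list [T_{j+n,j}, ..., T_{j,j}] (most recent first).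
lookupRev : List ℚ → ℕ → ℚ
lookupRev []       _       = 0ℚ
lookupRev (x ∷ xs) zero    = x
lookupRev (x ∷ xs) (suc m) = lookupRev xs m

invCol : Mat → ℕ → ℕ → List ℚ
invCol A j zero    = 1ℚ ∷ []
invCol A j (suc n) =
  let prev = invCol A j n
      -- prev has T_{j+m,j} at position n ∸ m, for m ≤ n
  in (- sumTo (suc n) (λ m → A (suc (j ℕ.+ n)) (j ℕ.+ m) * lookupRev prev (n ∸ m))) ∷ prev

inv : Mat → Mat
inv A i j = if j ≤ᵇ i then lookupRev (invCol A j (i ∸ j)) 0 else 0ℚ

natℚ : ℕ → ℚ
natℚ n = Data.Rational._/_ (+ n) 1

S : Mat
S i j = natℚ ((i C j) % 2)

Sx : ℚ → Mat
Sx x i j = if (j ≤ᵇ i) ∧ free (i ∸ j) j then x ^ℚ b (i ∸ j) else 0ℚ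

_^ℤ_ : Mat → ℤ → Mat
A ^ℤ (+ n)     = A ^M n
A ^ℤ -[1+ n ]  = inv A ^M suc n

-- S(x) is self-similar under binary expansion: writing i = 2a + r and j = 2c + s with
-- digits r, s, the entry S(x)(i, j) equals S₂(x)(r, s) · S(x)(a, c), where S₂(x) is the
-- 2 × 2 matrix [[1,0],[x,1]]; so S(x) is the infinite Kronecker power of S₂(x).  As
-- S₂(x) S₂(y) = S₂(x + y), induction on the binary length gives S(x) S(y) = S(x + y) and
-- S(0) = I, hence S(x)ⁿ = S(n x).  Pascal's rule for the support of S(1) is Lucas' theorem
-- mod 2, so S = S(1); then S(-1) is the triangular inverse of S, and S(p/q)^q = S(p) = S^p.
module Submission where

open import Defs
open import Data.Nat using (ℕ; NonZero)
open import Data.Integer using (ℤ)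
open import Data.Rational using (_/_)
open import Relation.Binary.PropositionalEquality using (_≡_)

open import Algebra.Bundles using (CommutativeRing)
open import Data.Bool.Base using (Bool; true; false; not; _∧_; _∨_; _xor_; if_then_else_)
open import Data.Bool.Properties using (xor-identityʳ; xor-same)
open import Data.Integer.Base as ℤ using (+_; -[1+_])
import Data.Integer.Properties as ℤ
open import Data.List.Base using (List; []; _∷_; _++_)
open import Data.List.Relation.Unary.All using (All; []; _∷_)
import Data.Nat as ℕ
open import Data.Nat.Base using (zero; suc; _∸_; _≤_; _<_; z≤n; s≤s; _≤ᵇ_; _≡ᵇ_; _%_)
open import Data.Nat.Combinatorics using (_C_; nCk+nC[k+1]≡[n+1]C[k+1])
open import Data.Nat.DivMod using (m/n≡1+[m∸n]/n; m/n<m; %-distribˡ-+)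
open import Data.Nat.Induction using (<-rec)
open import Data.Nat.Properties
  using ( ≤-refl; ≤-reflexive; ≤-trans; ≤-pred; n≤1+n; m≤n⇒m≤1+n; m≤m+n; m≤n⇒m<n∨m≡n
        ; +-suc; +-identityʳ; m+n∸m≡n; n∸n≡0; +-∸-assoc)
open import Data.Product.Base using (∃-syntax; _×_; _,_)
open import Data.Rational using (ℚ; 0ℚ; 1ℚ; _+_; _*_; -_; toℚᵘ)
import Data.Rational.Properties as ℚ
open import Data.Rational.Unnormalised.Base using (mkℚᵘ; *≡*; 1ℚᵘ) renaming (_≃_ to _≃ᵘ_)
import Data.Rational.Unnormalised.Properties as ℚᵘ
open import Data.Sum.Base using (inj₁; inj₂)
open import Function.Base using (_∘_; case_of_)
open import Relation.Nullary.Negation using (contradiction)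
open import Relation.Binary.PropositionalEquality
  using (_≢_; refl; sym; trans; cong; cong₂; module ≡-Reasoning)

open import Algebra.Properties.CommutativeSemigroup
  (CommutativeRing.*-commutativeSemigroup ℚ.+-*-commutativeRing) using (interchange)
open import Algebra.Properties.Group ℚ.+-0-group using (inverseʳ-unique)
open import Algebra.Properties.Semiring.Mult (CommutativeRing.semiring ℚ.+-*-commutativeRing)
  using (×-assoc-*) renaming (_×_ to _·_)

open ≡-Reasoning

-- Binary expansions

double : ℕ → ℕ
double zero    = zero
double (suc n) = suc (suc (double n))

bit : Bool → ℕ → ℕ
bit false a = double a
bit true  a = suc (double a)

data BitView : ℕ → Set where
  as-bit : ∀ r a → BitView (bit r a)

bitView : ∀ n → BitView n
bitView zero = as-bit false zero
bitView (suc n) with bitView n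
... | as-bit false a = as-bit true a
... | as-bit true  a = as-bit false (suc a)

n≤double : ∀ n → n ≤ double n
n≤double zero    = z≤n
n≤double (suc n) = s≤s (m≤n⇒m≤1+n (n≤double n))

n≤bit : ∀ r n → n ≤ bit r n
n≤bit false n = n≤double n
n≤bit true  n = m≤n⇒m≤1+n (n≤double n)

double-mono-≤ : ∀ {m n} → m ≤ n → double m ≤ double n
double-mono-≤ z≤n       = z≤n
double-mono-≤ (s≤s m≤n) = s≤s (s≤s (double-mono-≤ m≤n))

double-+ : ∀ m n → double (m ℕ.+ n) ≡ double m ℕ.+ double n
double-+ zero    n = refl
double-+ (suc m) n = cong (suc ∘ suc) (double-+ m n)

bit-mono-< : ∀ r s {a c} → a < c → bit r a < bit s c
bit-mono-< r s a<c = ≤-trans (s≤s (bit≤odd r)) (≤-trans (double-mono-≤ a<c) (double≤bit s))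
  where
  bit≤odd : ∀ r {a} → bit r a ≤ suc (double a)
  bit≤odd false = n≤1+n _
  bit≤odd true  = ≤-refl
  double≤bit : ∀ s {c} → double c ≤ bit s c
  double≤bit false = ≤-refl
  double≤bit true  = n≤1+n _

bit-ind : (P : ℕ → Set) → P 0 → (∀ r a → P a → P (bit r a)) → ∀ n → P n
bit-ind P base step = <-rec P go
  where
  go : ∀ n → (∀ {m} → m < n → P m) → P n
  go n rec with bitView n
  ... | as-bit false zero    = base
  ... | as-bit false (suc a) = step false (suc a) (rec (s≤s (s≤s (n≤double a))))
  ... | as-bit true  a       = step true a (rec (s≤s (n≤double a)))

bit-%2 : ∀ r a → (bit r a % 2 ≡ᵇ 1) ≡ r
bit-%2 false zero    = refl
bit-%2 true  zero    = refl
bit-%2 false (suc a) = bit-%2 false a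
bit-%2 true  (suc a) = bit-%2 true a

/2-suc-suc : ∀ n → suc (suc n) ℕ./ 2 ≡ suc (n ℕ./ 2)
/2-suc-suc n = m/n≡1+[m∸n]/n {suc (suc n)} {2} (s≤s (s≤s z≤n))

bit-/2 : ∀ r a → bit r a ℕ./ 2 ≡ a
bit-/2 false zero    = refl
bit-/2 true  zero    = refl
bit-/2 false (suc a) = trans (/2-suc-suc (double a)) (cong suc (bit-/2 false a))
bit-/2 true  (suc a) = trans (/2-suc-suc (suc (double a))) (cong suc (bit-/2 true a))

/2≤pred : ∀ {n f} → n ≤ suc f → n ℕ./ 2 ≤ f
/2≤pred {zero}  _         = z≤n
/2≤pred {suc n} (s≤s n≤f) = ≤-trans (≤-pred (m/n<m (suc n) 2 (s≤s (s≤s z≤n)))) n≤f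

Zeros : List Bool → Set
Zeros = All (_≡ false)

bitsFuel-zero : ∀ f → Zeros (bitsFuel f 0)
bitsFuel-zero zero    = []
bitsFuel-zero (suc f) = refl ∷ bitsFuel-zero f

bitsFuel-extend : ∀ {n f g} → n ≤ f → f ≤ g → ∃[ zs ] Zeros zs × bitsFuel g n ≡ bitsFuel f n ++ zs
bitsFuel-extend {f = zero}  {g}     z≤n _ = bitsFuel g 0 , bitsFuel-zero g , refl
bitsFuel-extend {n} {suc f} {suc g} n≤f (s≤s f≤g) =
  let zs , zeros , eq = bitsFuel-extend (/2≤pred n≤f) f≤g
  in  zs , zeros , cong ((n % 2 ≡ᵇ 1) ∷_) eq

bitsFuel-bit : ∀ f r a → bitsFuel (suc f) (bit r a) ≡ r ∷ bitsFuel f a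
bitsFuel-bit f r a = cong₂ (λ u n → u ∷ bitsFuel f n) (bit-%2 r a) (bit-/2 r a)

countOnes-++-Zeros : ∀ xs {zs} → Zeros zs → countOnes (xs ++ zs) ≡ countOnes xs
countOnes-++-Zeros []           []          = refl
countOnes-++-Zeros []           (refl ∷ zs) = countOnes-++-Zeros [] zs
countOnes-++-Zeros (true  ∷ xs) zs          = cong suc (countOnes-++-Zeros xs zs)
countOnes-++-Zeros (false ∷ xs) zs          = countOnes-++-Zeros xs zs

freeL-Zerosˡ : ∀ {zs} ys → Zeros zs → freeL zs ys ≡ true
freeL-Zerosˡ []       _           = refl
freeL-Zerosˡ (_ ∷ _)  []          = refl
freeL-Zerosˡ (_ ∷ ys) (refl ∷ zs) = freeL-Zerosˡ ys zs

freeL-Zerosʳ : ∀ xs {zs} → Zeros zs → freeL xs zs ≡ true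
freeL-Zerosʳ _            []          = refl
freeL-Zerosʳ []           (refl ∷ _)  = refl
freeL-Zerosʳ (false ∷ xs) (refl ∷ zs) = freeL-Zerosʳ xs zs
freeL-Zerosʳ (true  ∷ xs) (refl ∷ zs) = freeL-Zerosʳ xs zs

freeL-++-Zerosˡ : ∀ xs ys {zs} → Zeros zs → freeL (xs ++ zs) ys ≡ freeL xs ys
freeL-++-Zerosˡ _        []       _  = refl
freeL-++-Zerosˡ []       (y ∷ ys) zs = freeL-Zerosˡ (y ∷ ys) zs
freeL-++-Zerosˡ (x ∷ xs) (y ∷ ys) zs = cong (not (x ∧ y) ∧_) (freeL-++-Zerosˡ xs ys zs)

freeL-++-Zerosʳ : ∀ xs ys {zs} → Zeros zs → freeL xs (ys ++ zs) ≡ freeL xs ys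
freeL-++-Zerosʳ xs       []       zs = freeL-Zerosʳ xs zs
freeL-++-Zerosʳ []       (_ ∷ _)  _  = refl
freeL-++-Zerosʳ (x ∷ xs) (y ∷ ys) zs = cong (not (x ∧ y) ∧_) (freeL-++-Zerosʳ xs ys zs)

countOnes-bitsFuel : ∀ {n f} → n ≤ f → countOnes (bitsFuel f n) ≡ b n
countOnes-bitsFuel {n} n≤f =
  let zs , zeros , eq = bitsFuel-extend (≤-refl {n}) n≤f
  in  trans (cong countOnes eq) (countOnes-++-Zeros (bits n) zeros)

freeL-bitsFuel : ∀ {m c f g} → m ≤ f → c ≤ g → freeL (bitsFuel f m) (bitsFuel g c) ≡ free m c
freeL-bitsFuel {m} {c} {f} {g} m≤f c≤g =
  let zs₁ , zeros₁ , eq₁ = bitsFuel-extend (≤-refl {m}) m≤f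
      zs₂ , zeros₂ , eq₂ = bitsFuel-extend (≤-refl {c}) c≤g
  in  begin
    freeL (bitsFuel f m) (bitsFuel g c)   ≡⟨ cong₂ freeL eq₁ eq₂ ⟩
    freeL (bits m ++ zs₁) (bits c ++ zs₂) ≡⟨ freeL-++-Zerosˡ (bits m) (bits c ++ zs₂) zeros₁ ⟩
    freeL (bits m) (bits c ++ zs₂)        ≡⟨ freeL-++-Zerosʳ (bits m) (bits c) zeros₂ ⟩
    free m c                              ∎

b-bit : ∀ r a → b (bit r a) ≡ countOnes (r ∷ bitsFuel (bit r a) a)
b-bit r a = trans (sym (countOnes-bitsFuel (n≤1+n (bit r a)))) (cong countOnes (bitsFuel-bit _ r a))

b-double : ∀ a → b (double a) ≡ b a
b-double a = trans (b-bit false a) (countOnes-bitsFuel (n≤double a))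

b-suc-double : ∀ a → b (suc (double a)) ≡ suc (b a)
b-suc-double a = trans (b-bit true a) (cong suc (countOnes-bitsFuel (n≤bit true a)))

free-bit : ∀ r a s c → free (bit r a) (bit s c) ≡ not (r ∧ s) ∧ free a c
free-bit r a s c = begin
  free (bit r a) (bit s c)
    ≡⟨ sym (freeL-bitsFuel (n≤1+n (bit r a)) (n≤1+n (bit s c))) ⟩
  freeL (bitsFuel (suc (bit r a)) (bit r a)) (bitsFuel (suc (bit s c)) (bit s c))
    ≡⟨ cong₂ freeL (bitsFuel-bit (bit r a) r a) (bitsFuel-bit (bit s c) s c) ⟩
  not (r ∧ s) ∧ freeL (bitsFuel (bit r a) a) (bitsFuel (bit s c) c)
    ≡⟨ cong (not (r ∧ s) ∧_) (freeL-bitsFuel (n≤bit r a) (n≤bit s c)) ⟩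
  not (r ∧ s) ∧ free a c ∎

free-zero : ∀ j → free 0 j ≡ true
free-zero j = freeL-Zerosˡ (bits j) []

b≡0⇒≡0 : ∀ n → b n ≡ 0 → n ≡ 0
b≡0⇒≡0 = bit-ind (λ n → b n ≡ 0 → n ≡ 0) (λ _ → refl) step
  where
  step : ∀ r a → (b a ≡ 0 → a ≡ 0) → b (bit r a) ≡ 0 → bit r a ≡ 0
  step false a ih ba≡0 = cong double (ih (trans (sym (b-double a)) ba≡0))
  step true  a ih ba≡0 with () ← trans (sym (b-suc-double a)) ba≡0

-- Lower-triangular matrices

≤ᵇ-true : ∀ {j i} → j ≤ i → (j ≤ᵇ i) ≡ true
≤ᵇ-true z≤n               = refl
≤ᵇ-true (s≤s z≤n)         = refl
≤ᵇ-true (s≤s (s≤s j≤i))   = ≤ᵇ-true (s≤s j≤i)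

≤ᵇ-false : ∀ {i j} → i < j → (j ≤ᵇ i) ≡ false
≤ᵇ-false {zero}  (s≤s _)         = refl
≤ᵇ-false {suc i} (s≤s (s≤s i≤j)) = ≤ᵇ-false {i} (s≤s i≤j)

data Position : ℕ → ℕ → Set where
  lower : ∀ j m → Position (j ℕ.+ m) j
  upper : ∀ {i j} → i < j → Position i j

position : ∀ i j → Position i j
position i       zero    = lower zero i
position zero    (suc j) = upper (s≤s z≤n)
position (suc i) (suc j) with position i j
... | lower j m = lower (suc j) m
... | upper i<j = upper (s≤s i<j)

_≐_ : Mat → Mat → Set
A ≐ B = ∀ i j → A i j ≡ B i j

LowerTriangular : Mat → Set
LowerTriangular A = ∀ {i j} → i < j → A i j ≡ 0ℚ

I-diagonal : ∀ j → I j j ≡ 1ℚ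
I-diagonal zero    = refl
I-diagonal (suc j) = I-diagonal j

I-lower : ∀ j m → I (j ℕ.+ m) j ≡ (if m ≡ᵇ 0 then 1ℚ else 0ℚ)
I-lower zero    m = refl
I-lower (suc j) m = I-lower j m

I-lowerTriangular : LowerTriangular I
I-lowerTriangular {zero}  (s≤s _)         = refl
I-lowerTriangular {suc i} (s≤s (s≤s i≤j)) = I-lowerTriangular {i} (s≤s i≤j)

sumTo-cong : ∀ n {f g : ℕ → ℚ} → (∀ {k} → k < n → f k ≡ g k) → sumTo n f ≡ sumTo n g
sumTo-cong zero    _   = refl
sumTo-cong (suc n) f≡g = cong₂ _+_ (sumTo-cong n (f≡g ∘ m≤n⇒m≤1+n)) (f≡g ≤-refl)

sumTo-zero : ∀ n {f : ℕ → ℚ} → (∀ {k} → k < n → f k ≡ 0ℚ) → sumTo n f ≡ 0ℚ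
sumTo-zero zero    _      = refl
sumTo-zero (suc n) vanish = cong₂ _+_ (sumTo-zero n (vanish ∘ m≤n⇒m≤1+n)) (vanish ≤-refl)

sumTo-extend : ∀ {m n} {f : ℕ → ℚ} → (∀ {k} → m ≤ k → f k ≡ 0ℚ) → m ≤ n →
               sumTo n f ≡ sumTo m f
sumTo-extend {n = zero}  _      z≤n   = refl
sumTo-extend {n = suc n} vanish m≤1+n with m≤n⇒m<n∨m≡n m≤1+n
... | inj₁ (s≤s m≤n) = trans (cong₂ _+_ (sumTo-extend vanish m≤n) (vanish m≤n)) (ℚ.+-identityʳ _)
... | inj₂ refl      = refl

sumTo-+ : ∀ m n (f : ℕ → ℚ) → sumTo (m ℕ.+ n) f ≡ sumTo m f + sumTo n (λ k → f (m ℕ.+ k))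
sumTo-+ m zero    f = trans (cong (λ l → sumTo l f) (+-identityʳ m)) (sym (ℚ.+-identityʳ _))
sumTo-+ m (suc n) f = begin
  sumTo (m ℕ.+ suc n) f                                    ≡⟨ cong (λ l → sumTo l f) (+-suc m n) ⟩
  sumTo (m ℕ.+ n) f + f (m ℕ.+ n)                          ≡⟨ cong (_+ f (m ℕ.+ n)) (sumTo-+ m n f) ⟩
  (sumTo m f + sumTo n (λ k → f (m ℕ.+ k))) + f (m ℕ.+ n)  ≡⟨ ℚ.+-assoc (sumTo m f) _ _ ⟩
  sumTo m f + sumTo (suc n) (λ k → f (m ℕ.+ k))            ∎

sumTo-double : ∀ n (f : ℕ → ℚ) →
               sumTo (double n) f ≡ sumTo n (λ k → f (double k) + f (suc (double k)))
sumTo-double zero    f = refl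
sumTo-double (suc n) f =
  trans (ℚ.+-assoc (sumTo (double n) f) _ _) (cong (_+ (f (double n) + f (suc (double n)))) (sumTo-double n f))

sumTo-*ˡ : ∀ n c (f : ℕ → ℚ) → sumTo n (λ k → c * f k) ≡ c * sumTo n f
sumTo-*ˡ zero    c f = sym (ℚ.*-zeroʳ c)
sumTo-*ˡ (suc n) c f =
  trans (cong (_+ c * f n) (sumTo-*ˡ n c f)) (sym (ℚ.*-distribˡ-+ c (sumTo n f) (f n)))

⊗-cong : ∀ {A A′ B B′} → A ≐ A′ → B ≐ B′ → (A ⊗ B) ≐ (A′ ⊗ B′)
⊗-cong A≐A′ B≐B′ i j = sumTo-cong (suc i) (λ {k} _ → cong₂ _*_ (A≐A′ i k) (B≐B′ k j))

^M-cong : ∀ {A B} → A ≐ B → ∀ n → (A ^M n) ≐ (B ^M n)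
^M-cong A≐B zero    i j = refl
^M-cong A≐B (suc n) = ⊗-cong A≐B (^M-cong A≐B n)

⊗-lower-sumTo : ∀ {A} B → LowerTriangular A → ∀ {i n} j → i < n →
                (A ⊗ B) i j ≡ sumTo n (λ k → A i k * B k j)
⊗-lower-sumTo {A} B A-lower {i} j i<n =
  sym (sumTo-extend (λ {k} i<k → trans (cong (_* B k j) (A-lower i<k)) (ℚ.*-zeroˡ (B k j))) i<n)

module _ {A T : Mat} (A-diagonal : ∀ i → A i i ≡ 1ℚ) (T-lower : LowerTriangular T)
         (A⊗T≐I : (A ⊗ T) ≐ I) where

  private
    above-column : ∀ i j → sumTo j (λ k → A i k * T k j) ≡ 0ℚ
    above-column i j = sumTo-zero j (λ {k} k<j → trans (cong (A i k *_) (T-lower k<j)) (ℚ.*-zeroʳ (A i k)))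

  T-diagonal : ∀ j → T j j ≡ 1ℚ
  T-diagonal j = begin
    T j j            ≡⟨ sym (ℚ.*-identityˡ (T j j)) ⟩
    1ℚ * T j j       ≡⟨ sym (ℚ.+-identityˡ _) ⟩
    0ℚ + 1ℚ * T j j  ≡⟨ sym (cong₂ _+_ (above-column j j) (cong (_* T j j) (A-diagonal j))) ⟩
    (A ⊗ T) j j      ≡⟨ A⊗T≐I j j ⟩
    I j j            ≡⟨ I-diagonal j ⟩
    1ℚ               ∎

  T-below : ∀ j n →
            T (suc (j ℕ.+ n)) j ≡ - sumTo (suc n) (λ m → A (suc (j ℕ.+ n)) (j ℕ.+ m) * T (j ℕ.+ m) j)
  T-below j n = inverseʳ-unique Σ (T i j) (begin
    Σ + T i j                             ≡⟨ cong (_+ T i j) (sym (ℚ.+-identityˡ Σ)) ⟩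
    (0ℚ + Σ) + T i j                      ≡⟨ cong (λ z → (z + Σ) + T i j) (sym (above-column i j)) ⟩
    (sumTo j h + Σ) + T i j               ≡⟨ sym (cong₂ _+_ (sumTo-+ j (suc n) h) (ℚ.*-identityˡ (T i j))) ⟩
    sumTo (j ℕ.+ suc n) h + 1ℚ * T i j    ≡⟨ cong₂ _+_ (cong (λ l → sumTo l h) (+-suc j n))
                                                       (cong (_* T i j) (sym (A-diagonal i))) ⟩
    (A ⊗ T) i j                           ≡⟨ A⊗T≐I i j ⟩
    I i j                                 ≡⟨ cong (λ l → I l j) (sym (+-suc j n)) ⟩
    I (j ℕ.+ suc n) j                     ≡⟨ I-lower j (suc n) ⟩
    0ℚ                                    ∎)
    where
    i : ℕ
    i = suc (j ℕ.+ n)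
    h : ℕ → ℚ
    h k = A i k * T k j
    Σ : ℚ
    Σ = sumTo (suc n) (λ m → h (j ℕ.+ m))

  invCol-lookup : ∀ j n m → m ≤ n → lookupRev (invCol A j n) (n ∸ m) ≡ T (j ℕ.+ m) j
  invCol-lookup j zero zero z≤n = sym (trans (cong (λ i → T i j) (+-identityʳ j)) (T-diagonal j))
  invCol-lookup j (suc n) m m≤1+n with m≤n⇒m<n∨m≡n m≤1+n
  ... | inj₁ (s≤s m≤n) =
    trans (cong (lookupRev (invCol A j (suc n))) (+-∸-assoc 1 m≤n)) (invCol-lookup j n m m≤n)
  ... | inj₂ refl = begin
    lookupRev (invCol A j (suc n)) (n ∸ n)
      ≡⟨ cong (lookupRev (invCol A j (suc n))) (n∸n≡0 n) ⟩
    - sumTo (suc n) (λ m → A (suc (j ℕ.+ n)) (j ℕ.+ m) * lookupRev (invCol A j n) (n ∸ m))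
      ≡⟨ cong -_ (sumTo-cong (suc n) (λ {m} m<1+n → cong (A (suc (j ℕ.+ n)) (j ℕ.+ m) *_)
                                                       (invCol-lookup j n m (≤-pred m<1+n)))) ⟩
    - sumTo (suc n) (λ m → A (suc (j ℕ.+ n)) (j ℕ.+ m) * T (j ℕ.+ m) j)
      ≡⟨ sym (T-below j n) ⟩
    T (suc (j ℕ.+ n)) j
      ≡⟨ cong (λ i → T i j) (sym (+-suc j n)) ⟩
    T (j ℕ.+ suc n) j ∎

  inv-unique : inv A ≐ T
  inv-unique i j with position i j
  ... | upper i<j =
    trans (cong (λ t → if t then lookupRev (invCol A j (i ∸ j)) 0 else 0ℚ) (≤ᵇ-false i<j))
          (sym (T-lower i<j))
  ... | lower j m = begin
    inv A (j ℕ.+ m) j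
      ≡⟨ cong₂ (λ t n → if t then lookupRev (invCol A j n) 0 else 0ℚ)
               (≤ᵇ-true (m≤m+n j m)) (m+n∸m≡n j m) ⟩
    lookupRev (invCol A j m) 0
      ≡⟨ cong (lookupRev (invCol A j m)) (sym (n∸n≡0 m)) ⟩
    lookupRev (invCol A j m) (m ∸ m)
      ≡⟨ invCol-lookup j m m ≤-refl ⟩
    T (j ℕ.+ m) j ∎

-- ℚ normalises by a gcd, so these identities are checked on unnormalised representatives.

toℚᵘ-/ : ∀ p q → toℚᵘ (p / suc q) ≃ᵘ mkℚᵘ p q
toℚᵘ-/ p q = ℚ.toℚᵘ-fromℚᵘ (mkℚᵘ p q)

toℚᵘ-·-1ℚ : ∀ n → toℚᵘ (n · 1ℚ) ≃ᵘ mkℚᵘ (+ n) 0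
toℚᵘ-·-1ℚ zero    = ℚᵘ.≃-refl
toℚᵘ-·-1ℚ (suc n) =
  ℚᵘ.≃-trans (ℚ.toℚᵘ-homo-+ 1ℚ (n · 1ℚ))
  (ℚᵘ.≃-trans (ℚᵘ.+-congʳ 1ℚᵘ (toℚᵘ-·-1ℚ n)) (*≡* numerators))
  where
  numerators : (+ 1 ℤ.* + 1 ℤ.+ + n ℤ.* + 1) ℤ.* + 1 ≡ + suc n ℤ.* + 1
  numerators = trans (ℤ.*-identityʳ _)
    (trans (cong (ℤ._+_ (+ 1)) (ℤ.*-identityʳ (+ n))) (sym (ℤ.*-identityʳ (+ suc n))))

·-1ℚ : ∀ n → n · 1ℚ ≡ + n / 1
·-1ℚ n = ℚ.toℚᵘ-injective (ℚᵘ.≃-trans (toℚᵘ-·-1ℚ n) (ℚᵘ.≃-sym (toℚᵘ-/ (+ n) 0)))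

·-as-* : ∀ n x → n · x ≡ (+ n / 1) * x
·-as-* n x = begin
  n · x             ≡⟨ cong (n ·_) (sym (ℚ.*-identityˡ x)) ⟩
  n · (1ℚ * x)      ≡⟨ sym (×-assoc-* n 1ℚ x) ⟩
  (n · 1ℚ) * x      ≡⟨ cong (_* x) (·-1ℚ n) ⟩
  (+ n / 1) * x     ∎

·-/ : ∀ p q → suc q · (p / suc q) ≡ p / 1
·-/ p q = trans (·-as-* (suc q) (p / suc q)) (ℚ.toℚᵘ-injective
  (ℚᵘ.≃-trans (ℚ.toℚᵘ-homo-* (+ suc q / 1) (p / suc q))
  (ℚᵘ.≃-trans (ℚᵘ.*-cong (toℚᵘ-/ (+ suc q) 0) (toℚᵘ-/ p q))
  (ℚᵘ.≃-trans (*≡* numerators) (ℚᵘ.≃-sym (toℚᵘ-/ p 0))))))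
  where
  numerators : (+ suc q ℤ.* p) ℤ.* + 1 ≡ p ℤ.* + suc (q ℕ.+ 0)
  numerators = trans (ℤ.*-identityʳ _)
    (trans (ℤ.*-comm (+ suc q) p) (cong (λ z → p ℤ.* + suc z) (sym (+-identityʳ q))))

·-neg-1ℚ : ∀ n → n · (- 1ℚ) ≡ - (+ n / 1)
·-neg-1ℚ n =
  trans (·-as-* n (- 1ℚ)) (trans (sym (ℚ.neg-distribʳ-* (+ n / 1) 1ℚ)) (cong -_ (ℚ.*-identityʳ _)))

-- The matrices S(x)

entry : ℚ → ℕ → ℕ → ℚ
entry x m j = if free m j then x ^ℚ b m else 0ℚ

Sx-lower : ∀ x j m → Sx x (j ℕ.+ m) j ≡ entry x m j
Sx-lower x j m =
  cong₂ (λ t n → if t ∧ free n j then x ^ℚ b n else 0ℚ) (≤ᵇ-true (m≤m+n j m)) (m+n∸m≡n j m)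

Sx-lowerTriangular : ∀ x → LowerTriangular (Sx x)
Sx-lowerTriangular x {i} {j} i<j =
  cong (λ t → if t ∧ free (i ∸ j) j then x ^ℚ b (i ∸ j) else 0ℚ) (≤ᵇ-false i<j)

Sx-at : ∀ x {i j} m → i ≡ j ℕ.+ m → Sx x i j ≡ entry x m j
Sx-at x {j = j} m refl = Sx-lower x j m

entry-zero : ∀ x j → entry x 0 j ≡ 1ℚ
entry-zero x j = cong (λ t → if t then 1ℚ else 0ℚ) (free-zero j)

Sx-diagonal : ∀ x j → Sx x j j ≡ 1ℚ
Sx-diagonal x j = trans (Sx-at x 0 (sym (+-identityʳ j))) (entry-zero x j)

entry-double : ∀ x m s c → entry x (double m) (bit s c) ≡ entry x m c
entry-double x m s c = cong₂ (λ t n → if t then x ^ℚ n else 0ℚ) (free-bit false m s c) (b-double m)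

entry-odd-even : ∀ x m c → entry x (suc (double m)) (double c) ≡ x * entry x m c
entry-odd-even x m c =
  trans (cong₂ (λ t n → if t then x ^ℚ n else 0ℚ) (free-bit true m false c) (b-suc-double m))
        (pull-x (free m c))
  where
  pull-x : ∀ t → (if t then x * x ^ℚ b m else 0ℚ) ≡ x * (if t then x ^ℚ b m else 0ℚ)
  pull-x true  = refl
  pull-x false = sym (ℚ.*-zeroʳ x)

entry-odd-odd : ∀ x m c → entry x (suc (double m)) (suc (double c)) ≡ 0ℚ
entry-odd-odd x m c = cong (λ t → if t then x ^ℚ b (suc (double m)) else 0ℚ) (free-bit true m true c)

S₂ : ℚ → Bool → Bool → ℚ
S₂ x false false = 1ℚ
S₂ x false true  = 0ℚ
S₂ x true  false = x
S₂ x true  true  = 1ℚ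

Sx-bit-lower : ∀ x r s c m → Sx x (bit r (c ℕ.+ m)) (bit s c) ≡ S₂ x r s * entry x m c
Sx-bit-lower x false false c m =
  trans (Sx-at x (double m) (double-+ c m))
        (trans (entry-double x m false c) (sym (ℚ.*-identityˡ (entry x m c))))
Sx-bit-lower x true  true  c m =
  trans (Sx-at x (double m) (cong suc (double-+ c m)))
        (trans (entry-double x m true c) (sym (ℚ.*-identityˡ (entry x m c))))
Sx-bit-lower x true  false c m =
  trans (Sx-at x (suc (double m)) (trans (cong suc (double-+ c m)) (sym (+-suc (double c) (double m)))))
        (entry-odd-even x m c)
Sx-bit-lower x false true  c zero =
  trans (Sx-lowerTriangular x (s≤s (≤-reflexive (cong double (+-identityʳ c)))))
        (sym (ℚ.*-zeroˡ (entry x 0 c)))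
Sx-bit-lower x false true  c (suc m) =
  trans (Sx-at x (suc (double m)) (trans (double-+ c (suc m)) (+-suc (double c) (suc (double m)))))
        (trans (entry-odd-odd x m c) (sym (ℚ.*-zeroˡ (entry x (suc m) c))))

Sx-bit : ∀ x r a s c → Sx x (bit r a) (bit s c) ≡ S₂ x r s * Sx x a c
Sx-bit x r a s c with position a c
... | lower c m = trans (Sx-bit-lower x r s c m) (cong (S₂ x r s *_) (sym (Sx-lower x c m)))
... | upper a<c =
  trans (Sx-lowerTriangular x (bit-mono-< r s a<c))
        (sym (trans (cong (S₂ x r s *_) (Sx-lowerTriangular x a<c)) (ℚ.*-zeroʳ (S₂ x r s))))

S₂-⊗ : ∀ x y r s → S₂ x r false * S₂ y false s + S₂ x r true * S₂ y true s ≡ S₂ (x + y) r s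
S₂-⊗ x y false false = cong (_+_ 1ℚ) (ℚ.*-zeroˡ y)
S₂-⊗ x y false true  = refl
S₂-⊗ x y true  false = cong₂ _+_ (ℚ.*-identityʳ x) (ℚ.*-identityˡ y)
S₂-⊗ x y true  true  = cong (_+ 1ℚ) (ℚ.*-zeroʳ x)

Sx-⊗ : ∀ x y → (Sx x ⊗ Sx y) ≐ Sx (x + y)
Sx-⊗ x y = bit-ind (λ i → ∀ j → (Sx x ⊗ Sx y) i j ≡ Sx (x + y) i j) row-0 step
  where
  row-0 : ∀ j → (Sx x ⊗ Sx y) 0 j ≡ Sx (x + y) 0 j
  row-0 zero    = refl
  row-0 (suc j) = refl

  step : ∀ r a → (∀ c → (Sx x ⊗ Sx y) a c ≡ Sx (x + y) a c) →
         ∀ j → (Sx x ⊗ Sx y) (bit r a) j ≡ Sx (x + y) (bit r a) j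
  step r a ih j with bitView j
  ... | as-bit s c = begin
    (Sx x ⊗ Sx y) (bit r a) (bit s c)
      ≡⟨ ⊗-lower-sumTo (Sx y) (Sx-lowerTriangular x) (bit s c) (bit-mono-< r false ≤-refl) ⟩
    sumTo (double (suc a)) (λ k → Sx x (bit r a) k * Sx y k (bit s c))
      ≡⟨ sumTo-double (suc a) _ ⟩
    sumTo (suc a) (λ k → Sx x (bit r a) (bit false k) * Sx y (bit false k) (bit s c)
                       + Sx x (bit r a) (bit true k)  * Sx y (bit true k) (bit s c))
      ≡⟨ sumTo-cong (suc a) (λ {k} _ → block k) ⟩
    sumTo (suc a) (λ k → S₂ (x + y) r s * (Sx x a k * Sx y k c))
      ≡⟨ sumTo-*ˡ (suc a) (S₂ (x + y) r s) _ ⟩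
    S₂ (x + y) r s * (Sx x ⊗ Sx y) a c
      ≡⟨ cong (S₂ (x + y) r s *_) (ih c) ⟩
    S₂ (x + y) r s * Sx (x + y) a c
      ≡⟨ sym (Sx-bit (x + y) r a s c) ⟩
    Sx (x + y) (bit r a) (bit s c) ∎
    where
    block : ∀ k → Sx x (bit r a) (bit false k) * Sx y (bit false k) (bit s c)
                + Sx x (bit r a) (bit true k)  * Sx y (bit true k) (bit s c)
                ≡ S₂ (x + y) r s * (Sx x a k * Sx y k c)
    block k = begin
      Sx x (bit r a) (bit false k) * Sx y (bit false k) (bit s c)
        + Sx x (bit r a) (bit true k)  * Sx y (bit true k) (bit s c)
        ≡⟨ cong₂ _+_ (cong₂ _*_ (Sx-bit x r a false k) (Sx-bit y false k s c))
                     (cong₂ _*_ (Sx-bit x r a true k) (Sx-bit y true k s c)) ⟩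
      (S₂ x r false * X) * (S₂ y false s * Y) + (S₂ x r true * X) * (S₂ y true s * Y)
        ≡⟨ cong₂ _+_ (interchange (S₂ x r false) X (S₂ y false s) Y)
                     (interchange (S₂ x r true) X (S₂ y true s) Y) ⟩
      (S₂ x r false * S₂ y false s) * (X * Y) + (S₂ x r true * S₂ y true s) * (X * Y)
        ≡⟨ sym (ℚ.*-distribʳ-+ (X * Y) (S₂ x r false * S₂ y false s) _) ⟩
      (S₂ x r false * S₂ y false s + S₂ x r true * S₂ y true s) * (X * Y)
        ≡⟨ cong (_* (X * Y)) (S₂-⊗ x y r s) ⟩
      S₂ (x + y) r s * (X * Y) ∎
      where
      X Y : ℚ
      X = Sx x a k
      Y = Sx y k c

Sx-0 : Sx 0ℚ ≐ I
Sx-0 i j with position i j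
... | upper i<j = trans (Sx-lowerTriangular 0ℚ i<j) (sym (I-lowerTriangular i<j))
... | lower j m = trans (Sx-lower 0ℚ j m) (trans (entry-0 m) (sym (I-lower j m)))
  where
  0^ℚ : ∀ n → n ≢ 0 → 0ℚ ^ℚ n ≡ 0ℚ
  0^ℚ zero    n≢0 = contradiction refl n≢0
  0^ℚ (suc n) _   = ℚ.*-zeroˡ (0ℚ ^ℚ n)
  entry-0 : ∀ m → entry 0ℚ m j ≡ (if m ≡ᵇ 0 then 1ℚ else 0ℚ)
  entry-0 zero    = entry-zero 0ℚ j
  entry-0 (suc m) with free (suc m) j
  ... | true  = 0^ℚ (b (suc m)) (λ b≡0 → case b≡0⇒≡0 (suc m) b≡0 of λ ())
  ... | false = refl

Sx-^M : ∀ x n → (Sx x ^M n) ≐ Sx (n · x)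
Sx-^M x zero    i j = sym (Sx-0 i j)
Sx-^M x (suc n) i j = trans (⊗-cong {A = Sx x} (λ _ _ → refl) (Sx-^M x n) i j) (Sx-⊗ x (n · x) i j)

-- Lucas' theorem mod 2

support : ℕ → ℕ → Bool
support i j = (j ≤ᵇ i) ∧ free (i ∸ j) j

indicator : Bool → ℕ
indicator false = 0
indicator true  = 1

natℚ-indicator-injective : ∀ {t u} → natℚ (indicator t) ≡ natℚ (indicator u) → t ≡ u
natℚ-indicator-injective {false} {false} _ = refl
natℚ-indicator-injective {true}  {true}  _ = refl

Sx-1 : ∀ i j → Sx 1ℚ i j ≡ natℚ (indicator (support i j))
Sx-1 i j = ones (support i j) (b (i ∸ j))
  where
  1^ℚ : ∀ n → 1ℚ ^ℚ n ≡ 1ℚ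
  1^ℚ zero    = refl
  1^ℚ (suc n) = trans (ℚ.*-identityˡ _) (1^ℚ n)
  ones : ∀ t n → (if t then 1ℚ ^ℚ n else 0ℚ) ≡ natℚ (indicator t)
  ones true  n = 1^ℚ n
  ones false n = refl

support-bit : ∀ r a s c → support (bit r a) (bit s c) ≡ (r ∨ not s) ∧ support a c
support-bit r a s c = natℚ-indicator-injective (begin
  natℚ (indicator (support (bit r a) (bit s c)))  ≡⟨ sym (Sx-1 (bit r a) (bit s c)) ⟩
  Sx 1ℚ (bit r a) (bit s c)                       ≡⟨ Sx-bit 1ℚ r a s c ⟩
  S₂ 1ℚ r s * Sx 1ℚ a c                           ≡⟨ cong (S₂ 1ℚ r s *_) (Sx-1 a c) ⟩
  S₂ 1ℚ r s * natℚ (indicator (support a c))      ≡⟨ S₂-1 r s (support a c) ⟩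
  natℚ (indicator ((r ∨ not s) ∧ support a c))    ∎)
  where
  S₂-1 : ∀ r s t → S₂ 1ℚ r s * natℚ (indicator t) ≡ natℚ (indicator ((r ∨ not s) ∧ t))
  S₂-1 false false t = ℚ.*-identityˡ (natℚ (indicator t))
  S₂-1 false true  t = ℚ.*-zeroˡ (natℚ (indicator t))
  S₂-1 true  false t = ℚ.*-identityˡ (natℚ (indicator t))
  S₂-1 true  true  t = ℚ.*-identityˡ (natℚ (indicator t))

support-pascal : ∀ i j → support (suc i) (suc j) ≡ support i j xor support i (suc j)
support-pascal =
  bit-ind (λ i → ∀ j → support (suc i) (suc j) ≡ support i j xor support i (suc j)) row-0 step
  where
  row-0 : ∀ j → support 1 (suc j) ≡ support 0 j xor support 0 (suc j)
  row-0 zero    = refl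
  row-0 (suc j) = refl

  step : ∀ r a → (∀ c → support (suc a) (suc c) ≡ support a c xor support a (suc c)) →
         ∀ j → support (suc (bit r a)) (suc j) ≡ support (bit r a) j xor support (bit r a) (suc j)
  step r a ih j with bitView j
  step false a ih _ | as-bit false c =
    trans (support-bit true a true c)
          (sym (trans (cong₂ _xor_ (support-bit false a false c) (support-bit false a true c))
                      (xor-identityʳ (support a c))))
  step false a ih _ | as-bit true  c =
    trans (support-bit true a false (suc c))
          (sym (cong₂ _xor_ (support-bit false a true c) (support-bit false a false (suc c))))
  step true  a ih _ | as-bit false c =
    trans (support-bit false (suc a) true c)
          (sym (trans (cong₂ _xor_ (support-bit true a false c) (support-bit true a true c))
                      (xor-same (support a c))))
  step true  a ih _ | as-bit true  c =
    trans (support-bit false (suc a) false (suc c))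
          (trans (ih c) (sym (cong₂ _xor_ (support-bit true a true c) (support-bit true a false (suc c)))))

C-%2 : ∀ i j → (i C j) % 2 ≡ indicator (support i j)
C-%2 i       zero    = refl
C-%2 zero    (suc j) = refl
C-%2 (suc i) (suc j) = begin
  (suc i C suc j) % 2
    ≡⟨ cong (_% 2) (sym (nCk+nC[k+1]≡[n+1]C[k+1] i j)) ⟩
  (i C j ℕ.+ i C suc j) % 2
    ≡⟨ %-distribˡ-+ (i C j) (i C suc j) 2 ⟩
  ((i C j) % 2 ℕ.+ (i C suc j) % 2) % 2
    ≡⟨ cong₂ (λ u v → (u ℕ.+ v) % 2) (C-%2 i j) (C-%2 i (suc j)) ⟩
  (indicator (support i j) ℕ.+ indicator (support i (suc j))) % 2
    ≡⟨ indicator-xor (support i j) (support i (suc j)) ⟩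
  indicator (support i j xor support i (suc j))
    ≡⟨ cong indicator (sym (support-pascal i j)) ⟩
  indicator (support (suc i) (suc j)) ∎
  where
  indicator-xor : ∀ t u → (indicator t ℕ.+ indicator u) % 2 ≡ indicator (t xor u)
  indicator-xor false false = refl
  indicator-xor false true  = refl
  indicator-xor true  false = refl
  indicator-xor true  true  = refl

S≐Sx1 : S ≐ Sx 1ℚ
S≐Sx1 i j = trans (cong natℚ (C-%2 i j)) (sym (Sx-1 i j))

-- Integer powers of S

inv-S : inv S ≐ Sx (- 1ℚ)
inv-S = inv-unique S-diagonal (Sx-lowerTriangular (- 1ℚ)) S⊗Sx-1≐I
  where
  S-diagonal : ∀ i → S i i ≡ 1ℚ
  S-diagonal i = trans (S≐Sx1 i i) (Sx-diagonal 1ℚ i)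
  S⊗Sx-1≐I : (S ⊗ Sx (- 1ℚ)) ≐ I
  S⊗Sx-1≐I i j = begin
    (S ⊗ Sx (- 1ℚ)) i j      ≡⟨ ⊗-cong {B = Sx (- 1ℚ)} S≐Sx1 (λ _ _ → refl) i j ⟩
    (Sx 1ℚ ⊗ Sx (- 1ℚ)) i j  ≡⟨ Sx-⊗ 1ℚ (- 1ℚ) i j ⟩
    Sx 0ℚ i j                ≡⟨ Sx-0 i j ⟩
    I i j                    ∎

S^ℤ≐Sx : ∀ p → (S ^ℤ p) ≐ Sx (p / 1)
S^ℤ≐Sx (+ n) i j = begin
  (S ^M n) i j       ≡⟨ ^M-cong S≐Sx1 n i j ⟩
  (Sx 1ℚ ^M n) i j   ≡⟨ Sx-^M 1ℚ n i j ⟩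
  Sx (n · 1ℚ) i j    ≡⟨ cong (λ x → Sx x i j) (·-1ℚ n) ⟩
  Sx (+ n / 1) i j   ∎
S^ℤ≐Sx -[1+ n ] i j = begin
  (inv S ^M suc n) i j            ≡⟨ ^M-cong inv-S (suc n) i j ⟩
  (Sx (- 1ℚ) ^M suc n) i j        ≡⟨ Sx-^M (- 1ℚ) (suc n) i j ⟩
  Sx (suc n · (- 1ℚ)) i j         ≡⟨ cong (λ x → Sx x i j) (·-neg-1ℚ (suc n)) ⟩
  Sx (-[1+ n ] / 1) i j           ∎

theorem4 : (p : ℤ) (q : ℕ) .{{_ : NonZero q}} → (i j : ℕ) → (Sx (p / q) ^M q) i j ≡ (S ^ℤ p) i j
theorem4 p (suc q) i j = begin
  (Sx (p / suc q) ^M suc q) i j   ≡⟨ Sx-^M (p / suc q) (suc q) i j ⟩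
  Sx (suc q · (p / suc q)) i j    ≡⟨ cong (λ x → Sx x i j) (·-/ p q) ⟩
  Sx (p / 1) i j                  ≡⟨ sym (S^ℤ≐Sx p i j) ⟩
  (S ^ℤ p) i j                    ∎
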